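{- Let $G$ be a connected graph of order $n \ge 3$. Then $\gamma_{\rm it}^{\rm g}(G) < \frac{5}{6}n$.
   Context: All graphs are finite and simple. For a vertex set $S$, $N_G(S)$ denotes the set of vertices adjacent to at least one vertex of $S$, and $G - X$ is the graph obtained by deleting the vertices of $X$. The total isolation game on a graph $G$ is played by two players, Dominator and Staller, who alternately select vertices of $G$. If $S$ is the set of vertices selected so far, a vertex $v$ may be selected only if $v$ is adjacent to some vertex $u$ such that either $u$ belongs to a component of $G - N_G(S)$ of order at least $2$, or $u \in S$ and $u$ is an isolated vertex of $G - N_G(S)$. The game ends when no such vertex exists. Dominator aims to minimize the total number of selected vertices, Staller aims to maximize it. $\gamma_{\rm it}^{\rm g}(G)$ is the number of moves in the game in which Dominator makes the first move and both players play optimally. -}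

module Defs where

open import Data.Nat using (ℕ; zero; suc; _≤_)
open import Data.Fin using (Fin)
open import Data.Fin.Subset using (Subset; _∈_; _∪_; ⁅_⁆; ⊥)
open import Data.Bool using (Bool; T)
open import Data.Product using (Σ; ∃; _×_)
open import Data.Sum using (_⊎_)
open import Relation.Nullary using (¬_)
open import Relation.Binary.PropositionalEquality using (_≡_; _≢_)

record Graph (n : ℕ) : Set where
  field
    adj     : Fin n → Fin n → Bool
    adj-sym : ∀ u v → adj u v ≡ adj v u
    adj-irr : ∀ u → adj u u ≡ Data.Bool.false

open Graph public

module _ {n : ℕ} (G : Graph n) where

  Adj : Fin n → Fin n → Set
  Adj u v = T (adj G u v)

  data Path : Fin n → Fin n → Set where
    here : ∀ {u} → Path u u
    step : ∀ {u x w} → Adj u x → Path x w → Path u w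

  Connected : Set
  Connected = ∀ u v → Path u v

  InN : Subset n → Fin n → Set
  InN S u = ∃ λ w → w ∈ S × Adj w u

  Alive : Subset n → Fin n → Set
  Alive S u = ¬ InN S u

  data Reach (S : Subset n) : Fin n → Fin n → Set where
    here : ∀ {u} → Alive S u → Reach S u u
    step : ∀ {u x w} → Alive S u → Adj u x → Reach S x w → Reach S u w

  InBigComponent : Subset n → Fin n → Set
  InBigComponent S u = Alive S u × ∃ λ w → w ≢ u × Reach S u w

  IsolatedIn : Subset n → Fin n → Set
  IsolatedIn S u = Alive S u × (∀ w → Adj u w → ¬ Alive S w)

  Legal : Subset n → Fin n → Set
  Legal S v = ∃ λ u → Adj v u × (InBigComponent S u ⊎ (u ∈ S × IsolatedIn S u))

  data Player : Set where
    dominator staller : Player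

  other : Player → Player
  other dominator = staller
  other staller   = dominator

  Better : Player → ℕ → ℕ → Set
  Better dominator k x = k ≤ x
  Better staller   k x = x ≤ k

  GameOver : Subset n → Set
  GameOver S = ∀ v → ¬ Legal S v

  -- Value m p S k : with search depth m, from position S with p to move,
  -- under optimal play exactly k further moves are made.
  Value : ℕ → Player → Subset n → ℕ → Set
  Value zero    p S k = GameOver S × k ≡ 0
  Value (suc m) p S k =
      (GameOver S × k ≡ 0)
    ⊎ (Σ (Fin n) λ v → Legal S v × Σ ℕ λ k′ →
          Value m (other p) (S ∪ ⁅ v ⁆) k′ × k ≡ suc k′ ×
          (∀ v′ k″ → Legal S v′ → Value m (other p) (S ∪ ⁅ v′ ⁆) k″ → Better p k (suc k″)))

  -- γ_it^g(G) = k : the D-game (Dominator starts from the empty selection) has value k.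
  -- Every move selects a new vertex, so depth n suffices.
  TotalIsolationGameNumber : ℕ → Set
  TotalIsolationGameNumber k = Value n dominator ⊥ k

-- Weigh a position S by Ψ S = Σ W S x, where a vertex of a component of order at least 2 of
-- G - N_G(S) weighs 4, a selected vertex that is isolated in G - N_G(S) weighs 5, and every
-- other vertex 0; so Ψ ∅ ≤ 4n. A move v dominates its witness u, which loses at least 4, while
-- only v itself can gain weight (at most 1): every move lowers Ψ by at least 3, and by at least 5
-- once no component of order at least 2 remains (u is then selected and v was already dominated).
-- While such a component exists Dominator can lower Ψ by 7: for an edge ab of it he selects a
-- vertex with two neighbours in the component or, if the component is just {a, b}, a neighbour
-- c ∉ {a, b} of a (by connectivity and n ≥ 3), which dominates a and isolates b. Crediting
-- Staller with 2 while such a component exists, Ψ plus this credit drops by 5 per move, hence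
-- γ_it^g(G) ≤ 4n/5 < 5n/6.
module Submission where

open import Defs
open import Data.Nat using (ℕ; zero; suc; _+_; _*_; _∸_; _≤_; _<_; z≤n; s≤s; >-nonZero)
open import Data.Nat.Properties
open import Algebra.Properties.CommutativeMonoid.Sum +-0-commutativeMonoid using (sum; ∑-distrib-+)
open import Algebra.Properties.CommutativeSemigroup +-commutativeSemigroup using (x∙yz≈y∙xz)
open import Data.Bool using (T)
open import Data.Bool.Properties using (T?)
open import Data.Fin using (Fin; zero; suc)
open import Data.Fin.Properties as Fin using (any?)
open import Data.Fin.Subset using (Subset; _∈_; _∉_; _∪_; ⁅_⁆; _⊂_; ∣_∣; ⊤; ⊥)
open import Data.Fin.Subset.Properties
  using (_∈?_; x∈p∪q⁻; x∈p∪q⁺; x∈⁅x⁆; x∈⁅y⁆⇒x≡y; p⊆p∪q; p⊂q⇒∣p∣<∣q∣; ∣p∣≤n; ∣p∣≡n⇒p≡⊤; ∈⊤; ∉⊥)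
open import Data.Product using (∃; ∃₂; _×_; _,_; proj₁; proj₂)
open import Data.Sum using (_⊎_; inj₁; inj₂)
open import Data.Empty using (⊥-elim)
open import Function using (_∘_)
open import Relation.Nullary using (¬_; Dec; yes; no)
open import Relation.Nullary.Decidable using (map′; _×-dec_; _⊎-dec_; ¬?)
open import Relation.Unary using (Decidable)
open import Relation.Binary.Structures using (IsTotalPreorder; IsTotalOrder)
import Relation.Binary.Construct.Flip.EqAndOrd as Flip
open import Relation.Binary.PropositionalEquality using (_≡_; _≢_; refl; sym; trans; cong; cong₂; subst; ≢-sym)

sum-mono-≤ : ∀ {N} {f g : Fin N → ℕ} → (∀ x → f x ≤ g x) → sum f ≤ sum g
sum-mono-≤ {zero}  f≤g = z≤n
sum-mono-≤ {suc N} f≤g = +-mono-≤ (f≤g zero) (sum-mono-≤ (λ x → f≤g (suc x)))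

sum-mono-≤-except : ∀ {N} {f g : Fin N → ℕ} {e} (a : Fin N) →
                    (∀ x → x ≢ a → f x ≤ g x) → f a ≤ e + g a → sum f ≤ e + sum g
sum-mono-≤-except {suc N} {f} {g} {e} zero f≤g fa≤ = begin
  f zero + sum (f ∘ suc)        ≤⟨ +-mono-≤ fa≤ (sum-mono-≤ (λ x → f≤g (suc x) λ ())) ⟩
  e + g zero + sum (g ∘ suc)    ≡⟨ +-assoc e (g zero) _ ⟩
  e + (g zero + sum (g ∘ suc))  ∎
  where open ≤-Reasoning
sum-mono-≤-except {suc N} {f} {g} {e} (suc a) f≤g fa≤ = begin
  f zero + sum (f ∘ suc)        ≤⟨ +-mono-≤ (f≤g zero λ ()) (sum-mono-≤-except a f≤g∘suc fa≤) ⟩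
  g zero + (e + sum (g ∘ suc))  ≡⟨ x∙yz≈y∙xz (g zero) e _ ⟩
  e + (g zero + sum (g ∘ suc))  ∎
  where
  open ≤-Reasoning
  f≤g∘suc : ∀ x → x ≢ a → f (suc x) ≤ g (suc x)
  f≤g∘suc x x≢a = f≤g (suc x) (x≢a ∘ Fin.suc-injective)

f[a]≤sum : ∀ {N} (f : Fin N → ℕ) (a : Fin N) → f a ≤ sum f
f[a]≤sum f zero    = m≤m+n (f zero) _
f[a]≤sum f (suc a) = ≤-trans (f[a]≤sum (f ∘ suc) a) (m≤n+m _ (f zero))

f[a]+f[b]≤sum : ∀ {N} (f : Fin N → ℕ) {a b : Fin N} → a ≢ b → f a + f b ≤ sum f
f[a]+f[b]≤sum f {zero}  {zero}  a≢b = ⊥-elim (a≢b refl)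
f[a]+f[b]≤sum f {zero}  {suc b} _   = +-monoʳ-≤ (f zero) (f[a]≤sum (f ∘ suc) b)
f[a]+f[b]≤sum f {suc a} {zero}  _   =
  subst (_≤ sum f) (+-comm (f zero) _) (+-monoʳ-≤ (f zero) (f[a]≤sum (f ∘ suc) a))
f[a]+f[b]≤sum f {suc a} {suc b} a≢b =
  ≤-trans (f[a]+f[b]≤sum (f ∘ suc) (a≢b ∘ cong suc)) (m≤n+m _ (f zero))

sum≤n*c : ∀ {N} {f : Fin N → ℕ} {c} → (∀ x → f x ≤ c) → sum f ≤ N * c
sum≤n*c {zero}  f≤c = z≤n
sum≤n*c {suc N} f≤c = +-mono-≤ (f≤c zero) (sum≤n*c (f≤c ∘ suc))

m+[n∸m]≤o : ∀ {m n o} → m ≤ o → n ≤ o → m + (n ∸ m) ≤ o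
m+[n∸m]≤o {m} {n} m≤o n≤o with ≤-total m n
... | inj₁ m≤n = subst (_≤ _) (sym (m+[n∸m]≡n m≤n)) n≤o
... | inj₂ n≤m = subst (_≤ _) (sym (trans (cong (m +_) (m≤n⇒m∸n≡0 n≤m)) (+-identityʳ m))) m≤o

_⊕_ : ∀ {n} → Subset n → Fin n → Subset n
S ⊕ v = S ∪ ⁅ v ⁆

module _ {n} {S : Subset n} {v : Fin n} where

  ∈-⊕ : ∀ {x} → x ∈ S → x ∈ S ⊕ v
  ∈-⊕ x∈S = x∈p∪q⁺ (inj₁ x∈S)

  ∈-⊕-self : v ∈ S ⊕ v
  ∈-⊕-self = x∈p∪q⁺ (inj₂ (x∈⁅x⁆ v))

  ∈-⊕⁻ : ∀ {x} → x ∈ S ⊕ v → x ≢ v → x ∈ S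
  ∈-⊕⁻ x∈S⊕v x≢v with x∈p∪q⁻ S ⁅ v ⁆ x∈S⊕v
  ... | inj₁ x∈S = x∈S
  ... | inj₂ x∈v = ⊥-elim (x≢v (x∈⁅y⁆⇒x≡y v x∈v))

  ⊂-⊕ : v ∉ S → S ⊂ S ⊕ v
  ⊂-⊕ v∉S = p⊆p∪q _ , v , ∈-⊕-self , v∉S

weight : ∀ {A B : Set} → Dec A → Dec B → ℕ
weight (yes _) _       = 5
weight (no _)  (yes _) = 4
weight (no _)  (no _)  = 0

module _ {A B : Set} where

  weight≡0 : (a : Dec A) (b : Dec B) → ¬ A → ¬ B → weight a b ≡ 0
  weight≡0 (yes x) _       ¬A ¬B = ⊥-elim (¬A x)
  weight≡0 (no _)  (yes y) ¬A ¬B = ⊥-elim (¬B y)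
  weight≡0 (no _)  (no _)  ¬A ¬B = refl

  4≤weight : (a : Dec A) (b : Dec B) → A ⊎ B → 4 ≤ weight a b
  4≤weight (yes _) _       _        = n≤1+n 4
  4≤weight (no _)  (yes _) _        = ≤-refl
  4≤weight (no ¬A) (no _)  (inj₁ x) = ⊥-elim (¬A x)
  4≤weight (no _)  (no ¬B) (inj₂ y) = ⊥-elim (¬B y)

  5≤weight : (a : Dec A) (b : Dec B) → A → 5 ≤ weight a b
  5≤weight (yes _) _ _ = ≤-refl
  5≤weight (no ¬A) _ x = ⊥-elim (¬A x)

  weight≤4 : (a : Dec A) (b : Dec B) → ¬ A → weight a b ≤ 4
  weight≤4 (yes x) _       ¬A = ⊥-elim (¬A x)
  weight≤4 (no _)  (yes _) ¬A = ≤-refl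
  weight≤4 (no _)  (no _)  ¬A = z≤n

  weight-mono : ∀ {A′ B′ : Set} (a′ : Dec A′) (b′ : Dec B′) (a : Dec A) (b : Dec B) →
                (A′ → A) → (B′ → B) → weight a′ b′ ≤ weight a b
  weight-mono (yes x) _       a b A′⇒A B′⇒B = 5≤weight a b (A′⇒A x)
  weight-mono (no _)  (yes y) a b A′⇒A B′⇒B = 4≤weight a b (inj₂ (B′⇒B y))
  weight-mono (no _)  (no _)  a b A′⇒A B′⇒B = z≤n

  weight≤suc : ∀ {A′ B′ : Set} (a′ : Dec A′) (b′ : Dec B′) (a : Dec A) (b : Dec B) →
               (A′ → B) → (B′ → B) → weight a′ b′ ≤ suc (weight a b)
  weight≤suc (yes x) _       a b A′⇒B B′⇒B = s≤s (4≤weight a b (inj₂ (A′⇒B x)))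
  weight≤suc (no _)  (yes y) a b A′⇒B B′⇒B = m≤n⇒m≤1+n (4≤weight a b (inj₂ (B′⇒B y)))
  weight≤suc (no _)  (no _)  a b A′⇒B B′⇒B = z≤n

avoid-two : ∀ {n} → 3 ≤ n → (a b : Fin n) → ∃ λ z → z ≢ a × z ≢ b
avoid-two (s≤s (s≤s (s≤s _))) a b with zero Fin.≟ a | zero Fin.≟ b
... | no 0≢a   | no 0≢b = zero , 0≢a , 0≢b
... | yes refl | _ with suc zero Fin.≟ b
...   | no 1≢b   = suc zero , (λ ()) , 1≢b
...   | yes refl = suc (suc zero) , (λ ()) , (λ ())
avoid-two _ a b | no _ | yes refl with suc zero Fin.≟ a
...   | no 1≢a   = suc zero , 1≢a , (λ ())
...   | yes refl = suc (suc zero) , (λ ()) , (λ ())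

module _ {A : Set} {_≼_ : A → A → Set} (≼-total : IsTotalPreorder _≡_ _≼_) where

  open IsTotalPreorder ≼-total using (total) renaming (refl to ≼-refl; trans to ≼-trans)

  optimum : ∀ {N} {P : Fin N → Set} → Decidable P → (f : Fin N → A) →
            (∀ v → ¬ P v) ⊎ ∃ λ v → P v × ∀ w → P w → f v ≼ f w
  optimum {zero}  P? f = inj₁ λ ()
  optimum {suc N} P? f with optimum (P? ∘ suc) (f ∘ suc) | P? zero
  ... | inj₁ none | no ¬P0 = inj₁ λ { zero → ¬P0 ; (suc w) → none w }
  ... | inj₁ none | yes P0 = inj₂ (zero , P0 , λ { zero _ → ≼-refl ; (suc w) Pw → ⊥-elim (none w Pw) })
  ... | inj₂ (v , Pv , best) | no ¬P0 =
    inj₂ (suc v , Pv , λ { zero P0 → ⊥-elim (¬P0 P0) ; (suc w) Pw → best w Pw })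
  ... | inj₂ (v , Pv , best) | yes P0 with total (f zero) (f (suc v))
  ...   | inj₁ f0≼fv = inj₂ (zero , P0 , λ { zero _ → ≼-refl ; (suc w) Pw → ≼-trans f0≼fv (best w Pw) })
  ...   | inj₂ fv≼f0 = inj₂ (suc v , Pv , λ { zero _ → fv≼f0 ; (suc w) Pw → best w Pw })

module _ {n : ℕ} (G : Graph n) where

  Adj? : ∀ u v → Dec (Adj G u v)
  Adj? u v = T? (adj G u v)

  Adj-sym : ∀ {u v} → Adj G u v → Adj G v u
  Adj-sym {u} {v} = subst T (adj-sym G u v)

  Adj⇒≢ : ∀ {u v} → Adj G u v → u ≢ v
  Adj⇒≢ {u} uu refl = subst T (adj-irr G u) uu

  Path-exit : ∀ {P : Fin n → Set} → Decidable P → ∀ {y z} → Path G y z → P y → ¬ P z →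
              ∃₂ λ x c → P x × Adj G x c × ¬ P c
  Path-exit P? here                Py ¬Pz = ⊥-elim (¬Pz Py)
  Path-exit P? (step {x = x} yx p) Py ¬Pz with P? x
  ... | yes Px = Path-exit P? p Px ¬Pz
  ... | no ¬Px = _ , x , Py , yx , ¬Px

  Alive? : ∀ S u → Dec (Alive G S u)
  Alive? S u = ¬? (any? λ w → (w ∈? S) ×-dec Adj? w u)

  HasAliveNeighbour : Subset n → Fin n → Set
  HasAliveNeighbour S u = ∃ λ w → Adj G u w × Alive G S w

  NonIsolated : Subset n → Fin n → Set
  NonIsolated S u = Alive G S u × HasAliveNeighbour S u

  IsolatedSelected : Subset n → Fin n → Set
  IsolatedSelected S u = u ∈ S × Alive G S u

  NonIsolated? : ∀ S u → Dec (NonIsolated S u)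
  NonIsolated? S u = Alive? S u ×-dec any? λ w → Adj? u w ×-dec Alive? S w

  IsolatedSelected? : ∀ S u → Dec (IsolatedSelected S u)
  IsolatedSelected? S u = (u ∈? S) ×-dec Alive? S u

  Reach⇒Alive : ∀ {S u w} → Reach G S u w → Alive G S u
  Reach⇒Alive (here al)     = al
  Reach⇒Alive (step al _ _) = al

  InBigComponent⇒NonIsolated : ∀ {S u} → InBigComponent G S u → NonIsolated S u
  InBigComponent⇒NonIsolated (_  , _ , w≢u , here _)      = ⊥-elim (w≢u refl)
  InBigComponent⇒NonIsolated (al , _ , _   , step _ uw r) = al , _ , uw , Reach⇒Alive r

  NonIsolated⇒InBigComponent : ∀ {S u} → NonIsolated S u → InBigComponent G S u
  NonIsolated⇒InBigComponent (al , w , uw , alw) = al , w , ≢-sym (Adj⇒≢ uw) , step al uw (here alw)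

  IsolatedSelected⇒IsolatedIn : ∀ {S u} → IsolatedSelected S u → IsolatedIn G S u
  IsolatedSelected⇒IsolatedIn (u∈S , al) = al , λ w uw alw → alw (_ , u∈S , uw)

  Witness : Subset n → Fin n → Set
  Witness S u = NonIsolated S u ⊎ IsolatedSelected S u

  Legal⇒Witness : ∀ {S v} → Legal G S v → ∃ λ u → Adj G v u × Witness S u
  Legal⇒Witness (u , vu , inj₁ big)            = u , vu , inj₁ (InBigComponent⇒NonIsolated big)
  Legal⇒Witness (u , vu , inj₂ (u∈S , al , _)) = u , vu , inj₂ (u∈S , al)

  Witness⇒Legal : ∀ {S v u} → Adj G v u → Witness S u → Legal G S v
  Witness⇒Legal vu (inj₁ w) = _ , vu , inj₁ (NonIsolated⇒InBigComponent w)
  Witness⇒Legal vu (inj₂ w) = _ , vu , inj₂ (proj₁ w , IsolatedSelected⇒IsolatedIn w)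

  Legal? : ∀ S v → Dec (Legal G S v)
  Legal? S v = map′ (λ (_ , vu , w) → Witness⇒Legal vu w) Legal⇒Witness
    (any? λ u → Adj? v u ×-dec (NonIsolated? S u ⊎-dec IsolatedSelected? S u))

  Legal⇒HasAliveNeighbour : ∀ {S v} → Legal G S v → HasAliveNeighbour S v
  Legal⇒HasAliveNeighbour l with Legal⇒Witness l
  ... | _ , vu , inj₁ (al , _) = _ , vu , al
  ... | _ , vu , inj₂ (_ , al) = _ , vu , al

  Legal⇒∉ : ∀ {S v} → Legal G S v → v ∉ S
  Legal⇒∉ l v∈S = let _ , vw , alw = Legal⇒HasAliveNeighbour l in alw (_ , v∈S , vw)

  Alive-⊕⁻ : ∀ {S v x} → Alive G (S ⊕ v) x → Alive G S x
  Alive-⊕⁻ al (w , w∈S , wx) = al (w , ∈-⊕ w∈S , wx)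

  ¬Alive-⊕ : ∀ {S v x} → Adj G v x → ¬ Alive G (S ⊕ v) x
  ¬Alive-⊕ vx al = al (_ , ∈-⊕-self , vx)

  NonIsolated-⊕⁻ : ∀ {S v x} → NonIsolated (S ⊕ v) x → NonIsolated S x
  NonIsolated-⊕⁻ (al , w , xw , alw) = Alive-⊕⁻ al , w , xw , Alive-⊕⁻ alw

  W : Subset n → Fin n → ℕ
  W S x = weight (IsolatedSelected? S x) (NonIsolated? S x)

  Ψ : Subset n → ℕ
  Ψ S = sum (W S)

  -- Truncated only at v, the one vertex whose weight may grow.
  drop : Subset n → Fin n → Fin n → ℕ
  drop S v x = W S x ∸ W (S ⊕ v) x

  W-dead : ∀ {S x} → ¬ Alive G S x → W S x ≡ 0
  W-dead {S} {x} ¬al = weight≡0 (IsolatedSelected? S x) (NonIsolated? S x) (¬al ∘ proj₂) (¬al ∘ proj₁)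

  W-witness : ∀ {S u} → Witness S u → 4 ≤ W S u
  W-witness {S} {u} (inj₁ w) = 4≤weight (IsolatedSelected? S u) (NonIsolated? S u) (inj₂ w)
  W-witness {S} {u} (inj₂ w) = 4≤weight (IsolatedSelected? S u) (NonIsolated? S u) (inj₁ w)

  W-⊕ : ∀ {S v x} → x ≢ v → W (S ⊕ v) x ≤ W S x
  W-⊕ {S} {v} {x} x≢v =
    weight-mono (IsolatedSelected? (S ⊕ v) x) (NonIsolated? (S ⊕ v) x)
                (IsolatedSelected? S x) (NonIsolated? S x)
                (λ (x∈ , al) → ∈-⊕⁻ x∈ x≢v , Alive-⊕⁻ al) NonIsolated-⊕⁻

  W-⊕-self : ∀ {S v} → Legal G S v → W (S ⊕ v) v ≤ 1 + W S v
  W-⊕-self {S} {v} l =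
    weight≤suc (IsolatedSelected? (S ⊕ v) v) (NonIsolated? (S ⊕ v) v)
               (IsolatedSelected? S v) (NonIsolated? S v)
               (λ (_ , al) → Alive-⊕⁻ al , Legal⇒HasAliveNeighbour l) NonIsolated-⊕⁻

  drop-wiped : ∀ {S v x} → W (S ⊕ v) x ≡ 0 → drop S v x ≡ W S x
  drop-wiped {S} {v} {x} W≡0 = cong (W S x ∸_) W≡0

  W≤sum-drop : ∀ {S v x} → W (S ⊕ v) x ≡ 0 → W S x ≤ sum (drop S v)
  W≤sum-drop {S} {v} {x} W≡0 = subst (_≤ sum (drop S v)) (drop-wiped W≡0) (f[a]≤sum (drop S v) x)

  Ψ-⊕ : ∀ {S v e} → W (S ⊕ v) v ≤ e + W S v → Ψ (S ⊕ v) + sum (drop S v) ≤ e + Ψ S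
  Ψ-⊕ {S} {v} {e} gain = subst (_≤ e + Ψ S) (∑-distrib-+ (W (S ⊕ v)) (drop S v))
    (sum-mono-≤-except v (λ x x≢v → ≤-reflexive (m+[n∸m]≡n (W-⊕ x≢v)))
                         (m+[n∸m]≤o gain (m≤n+m _ e)))

  Ψ-descent : ∀ {S v e} d → W (S ⊕ v) v ≤ e + W S v → e + d ≤ sum (drop S v) → d + Ψ (S ⊕ v) ≤ Ψ S
  Ψ-descent {S} {v} {e} d gain e+d≤ = +-cancelˡ-≤ e _ _ (begin
    e + (d + Ψ (S ⊕ v))          ≡⟨ +-assoc e d _ ⟨
    e + d + Ψ (S ⊕ v)            ≤⟨ +-monoˡ-≤ _ e+d≤ ⟩
    sum (drop S v) + Ψ (S ⊕ v)   ≡⟨ +-comm (sum (drop S v)) _ ⟩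
    Ψ (S ⊕ v) + sum (drop S v)   ≤⟨ Ψ-⊕ gain ⟩
    e + Ψ S                      ∎)
    where open ≤-Reasoning

  Ψ-legal-descent : ∀ {S v} → Legal G S v → 3 + Ψ (S ⊕ v) ≤ Ψ S
  Ψ-legal-descent l with Legal⇒Witness l
  ... | _ , vu , w = Ψ-descent 3 (W-⊕-self l) (≤-trans (W-witness w) (W≤sum-drop (W-dead (¬Alive-⊕ vu))))

  Ψ-isolated-descent : ∀ {S v u} → Adj G v u → IsolatedSelected S u → 5 + Ψ (S ⊕ v) ≤ Ψ S
  Ψ-isolated-descent {S} {v} {u} vu (u∈S , alu) = Ψ-descent {e = 0} 5 no-gain
    (≤-trans (5≤weight (IsolatedSelected? S u) (NonIsolated? S u) (u∈S , alu))
             (W≤sum-drop (W-dead (¬Alive-⊕ vu))))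
    where
    no-gain : W (S ⊕ v) v ≤ W S v
    no-gain = subst (_≤ W S v) (sym (W-dead λ alv → alv (u , ∈-⊕ u∈S , Adj-sym vu))) z≤n

  Ψ-wipe-two : ∀ {S v a b} → Legal G S v → a ≢ b → W (S ⊕ v) a ≡ 0 → W (S ⊕ v) b ≡ 0 →
               NonIsolated S a → NonIsolated S b → 7 + Ψ (S ⊕ v) ≤ Ψ S
  Ψ-wipe-two {S} {v} {a} {b} l a≢b Wa≡0 Wb≡0 na nb = Ψ-descent 7 (W-⊕-self l) (begin
    8                           ≤⟨ +-mono-≤ (W-witness (inj₁ na)) (W-witness (inj₁ nb)) ⟩
    W S a + W S b               ≡⟨ cong₂ _+_ (drop-wiped Wa≡0) (drop-wiped Wb≡0) ⟨
    drop S v a + drop S v b     ≤⟨ f[a]+f[b]≤sum (drop S v) a≢b ⟩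
    sum (drop S v)              ∎)
    where open ≤-Reasoning

  HasGoodMove : Subset n → Set
  HasGoodMove S = ∃ λ v → Legal G S v × 7 + Ψ (S ⊕ v) ≤ Ψ S

  centre-move : ∀ {S a b d} → Alive G S b → Adj G b a → Alive G S a → Adj G b d → Alive G S d →
                a ≢ d → HasGoodMove S
  centre-move {b = b} alb ba ala bd ald a≢d =
    b , l , Ψ-wipe-two l a≢d (W-dead (¬Alive-⊕ ba)) (W-dead (¬Alive-⊕ bd))
                             (ala , b , Adj-sym ba , alb) (ald , b , Adj-sym bd , alb)
    where l = Witness⇒Legal ba (inj₁ (ala , b , Adj-sym ba , alb))

  -- Selecting c dominates a, and b, whose only neighbour in G - N_G(S) was a, becomes isolated.
  pendant-move : ∀ {S a b c} → Alive G S a → Alive G S b → Adj G a b →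
                 ¬ (∃ λ d → Adj G b d × Alive G S d × d ≢ a) → Adj G a c → c ≢ b → HasGoodMove S
  pendant-move {S} {a} {b} {c} ala alb ab only-a ac c≢b =
    c , l , Ψ-wipe-two l (Adj⇒≢ ab) (W-dead (¬Alive-⊕ (Adj-sym ac))) Wb≡0
                         (ala , b , ab , alb) (alb , a , Adj-sym ab , ala)
    where
    l = Witness⇒Legal (Adj-sym ac) (inj₁ (ala , b , ab , alb))
    b∉S⊕c : b ∉ S ⊕ c
    b∉S⊕c b∈ = ala (b , ∈-⊕⁻ b∈ (≢-sym c≢b) , Adj-sym ab)
    b-isolated : ¬ HasAliveNeighbour (S ⊕ c) b
    b-isolated (d , bd , ald) with d Fin.≟ a
    ... | yes refl = ¬Alive-⊕ (Adj-sym ac) ald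
    ... | no d≢a   = only-a (d , bd , Alive-⊕⁻ ald , d≢a)
    Wb≡0 : W (S ⊕ c) b ≡ 0
    Wb≡0 = weight≡0 (IsolatedSelected? (S ⊕ c) b) (NonIsolated? (S ⊕ c) b) (b∉S⊕c ∘ proj₁) (b-isolated ∘ proj₂)

  NonIsolated⇒HasGoodMove : Connected G → 3 ≤ n → ∀ {S a} → NonIsolated S a → HasGoodMove S
  NonIsolated⇒HasGoodMove conn 3≤n {S} {a} (ala , b , ab , alb)
    with any? (λ d → Adj? b d ×-dec Alive? S d ×-dec ¬? (d Fin.≟ a))
  ... | yes (d , bd , ald , d≢a) = centre-move alb (Adj-sym ab) ala bd ald (≢-sym d≢a)
  ... | no only-a with any? (λ d → Adj? a d ×-dec Alive? S d ×-dec ¬? (d Fin.≟ b))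
  ...   | yes (d , ad , ald , d≢b) = centre-move ala ab alb ad ald (≢-sym d≢b)
  ...   | no only-b with avoid-two 3≤n a b
  ...     | z , z≢a , z≢b
              with Path-exit (λ x → (x Fin.≟ a) ⊎-dec (x Fin.≟ b)) (conn a z) (inj₁ refl)
                             (λ { (inj₁ z≡a) → z≢a z≡a ; (inj₂ z≡b) → z≢b z≡b })
  ...       | _ , c , inj₁ refl , ac , c∉ab = pendant-move ala alb ab only-a ac (c∉ab ∘ inj₂)
  ...       | _ , c , inj₂ refl , bc , c∉ab = pendant-move alb ala (Adj-sym ab) only-b bc (c∉ab ∘ inj₁)

  Better-isTotalOrder : ∀ p → IsTotalOrder _≡_ (Better G p)
  Better-isTotalOrder dominator = ≤-isTotalOrder
  Better-isTotalOrder staller   = Flip.isTotalOrder ≤-isTotalOrder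

  Better-suc : ∀ p {k k′} → Better G p k k′ → Better G p (suc k) (suc k′)
  Better-suc dominator = s≤s
  Better-suc staller   = s≤s

  value-unique : ∀ m p S {k k′} → Value G m p S k → Value G m p S k′ → k ≡ k′
  value-unique zero    p S (_ , refl) (_ , refl) = refl
  value-unique (suc m) p S (inj₁ (_ , refl))  (inj₁ (_ , refl))  = refl
  value-unique (suc m) p S (inj₁ (over , _))  (inj₂ (v , l , _)) = ⊥-elim (over v l)
  value-unique (suc m) p S (inj₂ (v , l , _)) (inj₁ (over , _))  = ⊥-elim (over v l)
  value-unique (suc m) p S (inj₂ (v , l , k , V , refl , opt)) (inj₂ (v′ , l′ , k′ , V′ , refl , opt′)) =
    IsTotalOrder.antisym (Better-isTotalOrder p) (opt v′ k′ l′ V′) (opt′ v k l V)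

  moves-left-⊕ : ∀ {m S v} → n ≤ suc m + ∣ S ∣ → Legal G S v → n ≤ m + ∣ S ⊕ v ∣
  moves-left-⊕ {m} {S} n≤ l = ≤-trans n≤ (≤-trans (≤-reflexive (sym (+-suc m ∣ S ∣)))
    (+-monoʳ-≤ m (p⊂q⇒∣p∣<∣q∣ (⊂-⊕ (Legal⇒∉ l)))))

  value-exists : ∀ m p S → n ≤ m + ∣ S ∣ → ∃ (Value G m p S)
  value-exists zero p S n≤∣S∣ = 0 , (λ v l → Legal⇒∉ l (subst (v ∈_) (sym S≡⊤) ∈⊤)) , refl
    where S≡⊤ = ∣p∣≡n⇒p≡⊤ (≤-antisym (∣p∣≤n S) n≤∣S∣)
  value-exists (suc m) p S n≤ = choose
    (optimum (IsTotalOrder.isTotalPreorder (Better-isTotalOrder p)) (Legal? S) (λ v → after v (Legal? S v)))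
    where
    after : ∀ v → Dec (Legal G S v) → ℕ
    after v (yes l) = proj₁ (value-exists m (other G p) (S ⊕ v) (moves-left-⊕ n≤ l))
    after v (no _)  = 0

    after-value : ∀ {v} → Legal G S v → Value G m (other G p) (S ⊕ v) (after v (Legal? S v))
    after-value {v} l with Legal? S v
    ... | yes l′ = proj₂ (value-exists m (other G p) (S ⊕ v) (moves-left-⊕ n≤ l′))
    ... | no ¬l  = ⊥-elim (¬l l)

    choose : (∀ v → ¬ Legal G S v) ⊎
             (∃ λ v → Legal G S v × ∀ w → Legal G S w → Better G p (after v (Legal? S v)) (after w (Legal? S w))) →
             ∃ (Value G (suc m) p S)
    choose (inj₁ over) = 0 , inj₁ (over , refl)
    choose (inj₂ (v , l , best)) = _ , inj₂ (v , l , _ , after-value l , refl , λ w k l′ V →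
      Better-suc p (subst (Better G p _) (value-unique m (other G p) (S ⊕ w) (after-value l′) V) (best w l′)))

  bonus : Player G → Subset n → ℕ
  bonus dominator S = 0
  bonus staller   S with any? (NonIsolated? S)
  ... | yes _ = 2
  ... | no _  = 0

  Φ : Player G → Subset n → ℕ
  Φ p S = bonus p S + Ψ S

  bonus≤2 : ∀ p S → bonus p S ≤ 2
  bonus≤2 dominator S = z≤n
  bonus≤2 staller   S with any? (NonIsolated? S)
  ... | yes _ = ≤-refl
  ... | no _  = z≤n

  bonus-⊕ : ∀ p {S v} → ¬ ∃ (NonIsolated S) → bonus p (S ⊕ v) ≡ 0
  bonus-⊕ dominator none = refl
  bonus-⊕ staller {S} {v} none with any? (NonIsolated? (S ⊕ v))
  ... | yes (x , ni) = ⊥-elim (none (x , NonIsolated-⊕⁻ ni))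
  ... | no _         = refl

  isolated-descent : ∀ {S v} p → ¬ ∃ (NonIsolated S) → Legal G S v → 5 + Φ p (S ⊕ v) ≤ Ψ S
  isolated-descent {S} {v} p none l with Legal⇒Witness l
  ... | u , _  , inj₁ ni = ⊥-elim (none (u , ni))
  ... | _ , vu , inj₂ is =
    subst (λ b → 5 + (b + Ψ (S ⊕ v)) ≤ Ψ S) (sym (bonus-⊕ p none)) (Ψ-isolated-descent vu is)

  staller-descent : ∀ {S v} → Legal G S v → 5 + Φ dominator (S ⊕ v) ≤ Φ staller S
  staller-descent {S} l with any? (NonIsolated? S)
  ... | yes _   = +-monoʳ-≤ 2 (Ψ-legal-descent l)
  ... | no none = isolated-descent dominator none l

  module _ (conn : Connected G) (3≤n : 3 ≤ n) where

    dominator-descent : ∀ {S v} → Legal G S v → ∃ λ v* → Legal G S v* × 5 + Φ staller (S ⊕ v*) ≤ Φ dominator S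
    dominator-descent {S} {v} l with any? (NonIsolated? S)
    ... | yes (_ , ni) = let v* , l* , good = NonIsolated⇒HasGoodMove conn 3≤n ni in
      v* , l* , ≤-trans (+-monoʳ-≤ 5 (+-monoˡ-≤ (Ψ (S ⊕ v*)) (bonus≤2 staller (S ⊕ v*)))) good
    ... | no none = v , l , isolated-descent staller none l

    value-bound : ∀ m p S {k} → n ≤ m + ∣ S ∣ → Value G m p S k → 5 * k ≤ Φ p S
    value-bound zero    p S _ (_ , refl)        = z≤n
    value-bound (suc m) p S _ (inj₁ (_ , refl)) = z≤n
    value-bound (suc m) dominator S n≤ (inj₂ (v , l , k′ , _ , refl , opt)) =
      let v* , l* , descent = dominator-descent l
          k* , V* = value-exists m staller (S ⊕ v*) (moves-left-⊕ n≤ l*)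
      in begin
      5 * suc k′              ≤⟨ *-monoʳ-≤ 5 (opt v* k* l* V*) ⟩
      5 * suc k*              ≡⟨ *-suc 5 k* ⟩
      5 + 5 * k*              ≤⟨ +-monoʳ-≤ 5 (value-bound m staller (S ⊕ v*) (moves-left-⊕ n≤ l*) V*) ⟩
      5 + Φ staller (S ⊕ v*)  ≤⟨ descent ⟩
      Φ dominator S           ∎
      where open ≤-Reasoning
    value-bound (suc m) staller S n≤ (inj₂ (v , l , k′ , V , refl , _)) = begin
      5 * suc k′               ≡⟨ *-suc 5 k′ ⟩
      5 + 5 * k′               ≤⟨ +-monoʳ-≤ 5 (value-bound m dominator (S ⊕ v) (moves-left-⊕ n≤ l) V) ⟩
      5 + Φ dominator (S ⊕ v)  ≤⟨ staller-descent l ⟩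
      Φ staller S              ∎
      where open ≤-Reasoning

  Ψ⊥≤n*4 : Ψ ⊥ ≤ n * 4
  Ψ⊥≤n*4 = sum≤n*c λ x → weight≤4 (IsolatedSelected? ⊥ x) (NonIsolated? ⊥ x) (∉⊥ ∘ proj₁)

5k≤4n⇒6k<5n : ∀ {k n} → 5 * k ≤ n * 4 → 0 < n → 6 * k < 5 * n
5k≤4n⇒6k<5n {k} {n} 5k≤4n 0<n = *-cancelˡ-< 5 (6 * k) (5 * n) (begin-strict
  5 * (6 * k)  ≡⟨ *-assoc 5 6 k ⟨
  30 * k       ≡⟨ *-assoc 6 5 k ⟩
  6 * (5 * k)  ≤⟨ *-monoʳ-≤ 6 5k≤4n ⟩
  6 * (n * 4)  ≡⟨ cong (6 *_) (*-comm n 4) ⟩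
  6 * (4 * n)  ≡⟨ *-assoc 6 4 n ⟨
  24 * n       <⟨ *-monoˡ-< n ⦃ >-nonZero 0<n ⦄ {24} {25} ≤-refl ⟩
  25 * n       ≡⟨ *-assoc 5 5 n ⟩
  5 * (5 * n)  ∎)
  where open ≤-Reasoning

theorem4p1 : ∀ (n : ℕ) (G : Graph n) → 3 ≤ n → Connected G →
    ∃ λ k → TotalIsolationGameNumber G k × 6 * k < 5 * n
theorem4p1 n G 3≤n conn =
  let start = m≤m+n n ∣ ⊥ {n} ∣
      k , V = value-exists G n dominator ⊥ start
      5k≤4n = ≤-trans (value-bound G conn 3≤n n dominator ⊥ start V) (Ψ⊥≤n*4 G)
  in k , V , 5k≤4n⇒6k<5n {k} 5k≤4n (≤-trans (s≤s z≤n) 3≤n)
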